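{- Let $u$ be a principal factor of a word $w\in\mathbb{P}^*$ with principal index $i$. Let $C: w=v_0\to v_1\to\dots\to v_n=u$ be the lexicographically first maximal chain of $[u,w]$ whose chain id begins with $l_1=i$. Then $C(w,u)$ is a minimally skipped interval of $C$.
   Context: $\mathbb{P}=\{1,2,\dots\}$. Generalized factor order on $\mathbb{P}^*$: $u\le w$ iff for some $i\ge0$, $u(j)\le w(i+j)$ for $1\le j\le|u|$. Basic notions. - A word is flat if all letters are $1$. - An embedding of $v$ into $w$ is $\eta\in0^*v0^*$ of length $|w|$ with $\eta(k)\le w(k)$. - In an embedding of $v$, a letter is reducible if it exceeds $1$, or it is a $1$ that is the first nonzero letter, or $v$ is not flat and it is a $1$ that is the last nonzero letter. Reducing subtracts $1$. - In a word $w$, $w(k)$ is reducible if $w(k)>1$, or $w(k)=1$ and $k=1$, or $w(k)=1$, $k=|w|$ and $w$ not flat. Chain ids. A maximal chain has chain id $l_1\cdots l_n$ with $\eta_{v_0}=w$ and $\eta_{v_k}$ obtained from $\eta_{v_{k-1}}$ by reducing the reducible letter at position $l_k$. Chains are ordered lexicographically by chain id. Skipped intervals. A nonempty $C(v_a,v_b)=\{v_{a+1},\dots,v_{b-1}\}$ is skipped if $C\setminus C(v_a,v_b)\subseteq C'$ for an earlier maximal chain $C'$. It is minimally skipped if it properly contains no skipped interval. Principal factors. - Prefix: $|p|\le|w|$, $p(k)\le w(k)$ for $k\le|p|$. Suffix: analogous, aligned at the end. - Outer factor: a proper ($|p|<|w|$) prefix that is also a proper suffix. Maximal outer factor: not contained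 in a longer outer factor. - For a non-flat maximal outer factor $p$, its principal index is the least $k$ with $w(k)>p(k)$ ($p(k)=0$ for $k>|p|$) and $w(k)$ reducible. - $p$ is a principal factor if lowering $w(k)$ by $1$ gives a word no longer having $p$ as a suffix. -}

module Defs where

open import Data.Nat using (ℕ; zero; suc; _≤_; _<_; _∸_; _+_; pred)
open import Data.List using (List; []; _∷_; length; replicate; _++_; take; drop)
open import Data.List.Relation.Unary.All using (All)
open import Data.List.Relation.Binary.Pointwise using (Pointwise)
open import Data.List.Relation.Binary.Lex.Strict using (Lex-<)
open import Data.List.Membership.Propositional using (_∈_)
open import Data.Product using (Σ; ∃; _×_; _,_)
open import Data.Sum using (_⊎_)
open import Relation.Nullary using (¬_)
open import Relation.Binary.PropositionalEquality using (_≡_; _≢_)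

-- Words over ℙ = {1,2,...} are lists of naturals all of whose entries
-- are ≥ 1.  Positions are 1-indexed; out-of-range positions read as 0.

Word : List ℕ → Set
Word w = All (λ a → 1 ≤ a) w

at : List ℕ → ℕ → ℕ
at [] _ = 0
at (x ∷ xs) zero = 0
at (x ∷ xs) (suc zero) = x
at (x ∷ xs) (suc (suc k)) = at xs (suc k)

decAt : List ℕ → ℕ → List ℕ
decAt [] _ = []
decAt (x ∷ xs) zero = x ∷ xs
decAt (x ∷ xs) (suc zero) = pred x ∷ xs
decAt (x ∷ xs) (suc (suc k)) = x ∷ decAt xs (suc k)

removeZeros : List ℕ → List ℕ
removeZeros [] = []
removeZeros (zero ∷ xs) = removeZeros xs
removeZeros (suc x ∷ xs) = suc x ∷ removeZeros xs

Flat : List ℕ → Set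
Flat w = All (λ a → a ≡ 1) w

_≼_ : List ℕ → List ℕ → Set
u ≼ w = ∃ λ i → (i + length u ≤ length w) ×
          (∀ j → 1 ≤ j → j ≤ length u → at u j ≤ at w (i + j))

_≺_ : List ℕ → List ℕ → Set
u ≺ w = u ≼ w × u ≢ w

_⋖_ : List ℕ → List ℕ → Set
v ⋖ w = Word v × Word w × v ≺ w × (∀ x → Word x → v ≺ x → ¬ (x ≺ w))

-- MaxChain b t C : C = (t = v₀, v₁, …, vₙ = b) with v_{k+1} ⋖ v_k,
-- i.e. C is a maximal chain of the interval [b, t], listed from the top.
data MaxChain (b : List ℕ) : List ℕ → List (List ℕ) → Set where
  base : MaxChain b b (b ∷ [])
  step : ∀ {t t' C} → t' ⋖ t → MaxChain b t' C → MaxChain b t (t ∷ C)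

Embedding : List ℕ → List ℕ → List ℕ → Set
Embedding v w η =
  (∃ λ i → ∃ λ j → η ≡ replicate i 0 ++ v ++ replicate j 0) ×
  Pointwise _≤_ η w

FirstNonzero : List ℕ → ℕ → Set
FirstNonzero η k = at η k ≢ 0 × (∀ j → j < k → at η j ≡ 0)

LastNonzero : List ℕ → ℕ → Set
LastNonzero η k = at η k ≢ 0 × (∀ j → k < j → at η j ≡ 0)

ReducibleEmb : List ℕ → List ℕ → ℕ → Set
ReducibleEmb v η k =
  (1 < at η k)
  ⊎ (at η k ≡ 1 × FirstNonzero η k)
  ⊎ (¬ Flat v × at η k ≡ 1 × LastNonzero η k)

ReducibleWord : List ℕ → ℕ → Set
ReducibleWord w k =
  (1 < at w k)
  ⊎ (at w k ≡ 1 × k ≡ 1)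
  ⊎ (at w k ≡ 1 × k ≡ length w × ¬ Flat w)

-- IdsFrom w η C l : starting from the embedding η (of head C into w),
-- successively reducing the reducible letters at positions l₁, l₂, …
-- yields embeddings of the successive words of C.
data IdsFrom (w : List ℕ) : List ℕ → List (List ℕ) → List ℕ → Set where
  end  : ∀ {η v} → Embedding v w η → IdsFrom w η (v ∷ []) []
  step : ∀ {η v vs l ls} → Embedding v w η → ReducibleEmb v η l →
         IdsFrom w (decAt η l) vs ls → IdsFrom w η (v ∷ vs) (l ∷ ls)

ChainId : List ℕ → List (List ℕ) → List ℕ → Set
ChainId w C l = IdsFrom w w C l

_<lex_ : List ℕ → List ℕ → Set
_<lex_ = Lex-< _≡_ _<_

-- Skipped intervals.  C = v₀ … vₙ is a maximal chain of [u,w] with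
-- chain id l.  The interval C(v_a,v_b) = {v_{a+1},…,v_{b-1}}; its
-- complement in C is take (a+1) C ++ drop b C.

Skipped : List ℕ → List ℕ → List (List ℕ) → List ℕ → ℕ → ℕ → Set
Skipped u w C l a b =
  suc a < b × b < length C ×
  (∃ λ C' → ∃ λ l' → MaxChain u w C' × ChainId w C' l' × l' <lex l ×
     All (λ v → v ∈ C') (take (suc a) C ++ drop b C))

MinSkipped : List ℕ → List ℕ → List (List ℕ) → List ℕ → ℕ → ℕ → Set
MinSkipped u w C l a b =
  Skipped u w C l a b ×
  (∀ a' b' → a ≤ a' → b' ≤ b → ¬ (a' ≡ a × b' ≡ b) → ¬ Skipped u w C l a' b')

Prefix : List ℕ → List ℕ → Set
Prefix p w = length p ≤ length w ×
  (∀ k → 1 ≤ k → k ≤ length p → at p k ≤ at w k)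

Suffix : List ℕ → List ℕ → Set
Suffix p w = length p ≤ length w ×
  (∀ k → 1 ≤ k → k ≤ length p → at p k ≤ at w ((length w ∸ length p) + k))

OuterFactor : List ℕ → List ℕ → Set
OuterFactor p w = Word p × length p < length w × Prefix p w × Suffix p w

MaximalOuterFactor : List ℕ → List ℕ → Set
MaximalOuterFactor p w = OuterFactor p w ×
  (∀ q → OuterFactor q w → length p < length q → ¬ (p ≼ q))

PrincipalIndex : List ℕ → List ℕ → ℕ → Set
PrincipalIndex w p k =
  at p k < at w k × ReducibleWord w k ×
  (∀ j → j < k → ¬ (at p j < at w j × ReducibleWord w j))

lower : List ℕ → ℕ → List ℕ
lower w k = removeZeros (decAt w k)

PrincipalFactor : List ℕ → List ℕ → ℕ → Set
PrincipalFactor p w i =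
  MaximalOuterFactor p w × ¬ Flat p × PrincipalIndex w p i ×
  ¬ Suffix p (lower w i)

-- The chain skipping C(w,u) is the greedy one whose id starts with 1: lowering w(1), and then
-- repeatedly a letter in which the current embedding exceeds the suffix copy of u, descends to u;
-- and 1 < i because lowering w(1) leaves u a suffix. An earlier chain that meets C outside a
-- proper subinterval starts with some j ≤ i. For j = i its id is lexicographically smaller,
-- contradicting the choice of C. For j < i its embedding of u is a prefix or a suffix copy, u being
-- a maximal outer factor. A prefix copy makes j a candidate below the principal index. A suffix
-- copy cannot lie below v₁, since u is not a suffix of lower w i. Nor can it lie below the
-- penultimate word x of C: C ends in the prefix copy of u and, by lexicographic minimality, its
-- last step lowers a letter beyond u, so x is u followed by a 1, and a suffix copy of u inside x
-- would force u to be flat.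

module Submission where

open import Data.Empty using (⊥; ⊥-elim)
open import Data.List using (List; []; _∷_; length; replicate; _++_; take; drop; initLast; _∷ʳ′_)
open import Data.List.Properties using (length-++; length-replicate; ++-identityʳ; ++-assoc)
open import Data.Nat.ListAction using (sum)
open import Data.Nat.ListAction.Properties using (sum-++)
open import Data.List.Membership.Propositional using (_∈_)
open import Data.List.Membership.Propositional.Properties using (∈-++⁺ˡ; ∈-++⁺ʳ)
open import Data.List.Relation.Binary.Lex.Strict using (this; next; halt)
open import Data.List.Relation.Binary.Pointwise using (Pointwise; []; _∷_; Pointwise-length)
open import Data.List.Relation.Unary.All as All using (All; []; _∷_)
open import Data.List.Relation.Unary.All.Properties using (++⁺)
open import Data.List.Relation.Unary.Any using (here; there)
open import Data.Nat
open import Data.Nat.Properties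
open import Data.Product
open import Data.Sum using (_⊎_; inj₁; inj₂; [_,_]′)
open import Function using (_∘_)
open import Relation.Binary.PropositionalEquality
open import Relation.Nullary using (¬_; yes; no; Dec)

open import Defs

infix 4 _⊑_

_⊑_ : List ℕ → List ℕ → Set
η ⊑ η′ = ∀ k → at η k ≤ at η′ k

at-zero : ∀ v → at v 0 ≡ 0
at-zero []      = refl
at-zero (_ ∷ _) = refl

at-zeros : ∀ b k → at (replicate b 0) k ≡ 0
at-zeros zero    k             = refl
at-zeros (suc b) zero          = refl
at-zeros (suc b) (suc zero)    = refl
at-zeros (suc b) (suc (suc k)) = at-zeros b (suc k)

at-++-zeros : ∀ v b k → at (v ++ replicate b 0) k ≡ at v k
at-++-zeros []      b k             = at-zeros b k
at-++-zeros (x ∷ v) b zero          = refl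
at-++-zeros (x ∷ v) b (suc zero)    = refl
at-++-zeros (x ∷ v) b (suc (suc k)) = at-++-zeros v b (suc k)

at-padded : ∀ a v b k → at (replicate a 0 ++ v ++ replicate b 0) k ≡ at v (k ∸ a)
at-padded zero    v b k             = at-++-zeros v b k
at-padded (suc a) v b zero          = sym (at-zero v)
at-padded (suc a) v b (suc zero)    = sym (trans (cong (at v) (0∸n≡0 a)) (at-zero v))
at-padded (suc a) v b (suc (suc k)) = at-padded a v b (suc k)

at≢0⇒inRange : ∀ v {k} → at v k ≢ 0 → 1 ≤ k × k ≤ length v
at≢0⇒inRange []      nz = ⊥-elim (nz refl)
at≢0⇒inRange (x ∷ v) {zero}        nz = ⊥-elim (nz refl)
at≢0⇒inRange (x ∷ v) {suc zero}    nz = s≤s z≤n , s≤s z≤n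
at≢0⇒inRange (x ∷ v) {suc (suc k)} nz = s≤s z≤n , s≤s (proj₂ (at≢0⇒inRange v nz))

at-beyond : ∀ v {k} → length v < k → at v k ≡ 0
at-beyond []      _ = refl
at-beyond (x ∷ v) {suc (suc k)} (s≤s lt) = at-beyond v lt

at-injective : ∀ xs ys → length xs ≡ length ys → (∀ k → at xs k ≡ at ys k) → xs ≡ ys
at-injective []       []       _   _ = refl
at-injective (x ∷ xs) (y ∷ ys) len h =
  cong₂ _∷_ (h 1) (at-injective xs ys (suc-injective len) tail)
  where
  tail : ∀ k → at xs k ≡ at ys k
  tail zero    = trans (at-zero xs) (sym (at-zero ys))
  tail (suc k) = h (suc (suc k))

at≤sum : ∀ η k → at η k ≤ sum η
at≤sum []      k             = z≤n
at≤sum (x ∷ η) zero          = z≤n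
at≤sum (x ∷ η) (suc zero)    = m≤m+n x (sum η)
at≤sum (x ∷ η) (suc (suc k)) = ≤-trans (at≤sum η (suc k)) (m≤n+m (sum η) x)

pointwise⇒⊑ : ∀ {xs ys} → Pointwise _≤_ xs ys → xs ⊑ ys
pointwise⇒⊑ []        k             = z≤n
pointwise⇒⊑ (_ ∷ p)   zero          = z≤n
pointwise⇒⊑ (x≤y ∷ p) (suc zero)    = x≤y
pointwise⇒⊑ (_ ∷ p)   (suc (suc k)) = pointwise⇒⊑ p (suc k)

⊑⇒pointwise : ∀ xs ys → length xs ≡ length ys → xs ⊑ ys → Pointwise _≤_ xs ys
⊑⇒pointwise []       []       _   _ = []
⊑⇒pointwise (x ∷ xs) (y ∷ ys) len h =
  h 1 ∷ ⊑⇒pointwise xs ys (suc-injective len) tail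
  where
  tail : xs ⊑ ys
  tail zero    = ≤-reflexive (trans (at-zero xs) (sym (at-zero ys)))
  tail (suc k) = h (suc (suc k))

length-decAt : ∀ η l → length (decAt η l) ≡ length η
length-decAt []      l             = refl
length-decAt (x ∷ η) zero          = refl
length-decAt (x ∷ η) (suc zero)    = refl
length-decAt (x ∷ η) (suc (suc l)) = cong suc (length-decAt η (suc l))

at-decAt-≡ : ∀ η l → at (decAt η l) l ≡ pred (at η l)
at-decAt-≡ []      l             = refl
at-decAt-≡ (x ∷ η) zero          = refl
at-decAt-≡ (x ∷ η) (suc zero)    = refl
at-decAt-≡ (x ∷ η) (suc (suc l)) = at-decAt-≡ η (suc l)

at-decAt-≢ : ∀ η {l k} → k ≢ l → at (decAt η l) k ≡ at η k
at-decAt-≢ []      _ = refl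
at-decAt-≢ (x ∷ η) {zero}        _ = refl
at-decAt-≢ (x ∷ η) {suc zero}    {zero}        _  = refl
at-decAt-≢ (x ∷ η) {suc zero}    {suc zero}    ne = ⊥-elim (ne refl)
at-decAt-≢ (x ∷ η) {suc zero}    {suc (suc k)} _  = refl
at-decAt-≢ (x ∷ η) {suc (suc l)} {zero}        _  = refl
at-decAt-≢ (x ∷ η) {suc (suc l)} {suc zero}    _  = refl
at-decAt-≢ (x ∷ η) {suc (suc l)} {suc (suc k)} ne = at-decAt-≢ η (ne ∘ cong suc)

decAt-⊑ : ∀ η l → decAt η l ⊑ η
decAt-⊑ η l k with k ≟ l
... | yes refl = subst (_≤ at η k) (sym (at-decAt-≡ η k)) pred[n]≤n
... | no  k≢l  = ≤-reflexive (at-decAt-≢ η k≢l)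

decAt-comm : ∀ η p q → decAt (decAt η q) p ≡ decAt (decAt η p) q
decAt-comm η p q = at-injective _ _ lengths pointwise
  where
  lengths : length (decAt (decAt η q) p) ≡ length (decAt (decAt η p) q)
  lengths = trans (length-decAt (decAt η q) p) (trans (length-decAt η q)
              (sym (trans (length-decAt (decAt η p) q) (length-decAt η p))))
  pointwise : ∀ k → at (decAt (decAt η q) p) k ≡ at (decAt (decAt η p) q) k
  pointwise k with k ≟ p | k ≟ q
  ... | yes refl | yes refl = refl
  ... | yes refl | no  k≢q  = begin
    at (decAt (decAt η q) k) k ≡⟨ at-decAt-≡ (decAt η q) k ⟩
    pred (at (decAt η q) k)    ≡⟨ cong pred (at-decAt-≢ η k≢q) ⟩
    pred (at η k)              ≡⟨ sym (at-decAt-≡ η k) ⟩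
    at (decAt η k) k           ≡⟨ sym (at-decAt-≢ (decAt η k) k≢q) ⟩
    at (decAt (decAt η k) q) k ∎
    where open ≡-Reasoning
  ... | no  k≢p  | yes refl = begin
    at (decAt (decAt η k) p) k ≡⟨ at-decAt-≢ (decAt η k) k≢p ⟩
    at (decAt η k) k           ≡⟨ at-decAt-≡ η k ⟩
    pred (at η k)              ≡⟨ cong pred (sym (at-decAt-≢ η k≢p)) ⟩
    pred (at (decAt η p) k)    ≡⟨ sym (at-decAt-≡ (decAt η p) k) ⟩
    at (decAt (decAt η p) k) k ∎
    where open ≡-Reasoning
  ... | no  k≢p  | no  k≢q  = trans (at-decAt-≢ (decAt η q) k≢p) (trans (at-decAt-≢ η k≢q)
                                (sym (trans (at-decAt-≢ (decAt η p) k≢q) (at-decAt-≢ η k≢p))))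

sum-decAt : ∀ η l → 1 ≤ at η l → suc (sum (decAt η l)) ≡ sum η
sum-decAt (suc x ∷ η) (suc zero)    _ = refl
sum-decAt (x ∷ η)     (suc (suc l)) h = trans (sym (+-suc x _)) (cong (x +_) (sum-decAt η (suc l) h))

word-at : ∀ {v} → Word v → ∀ {k} → 1 ≤ k → k ≤ length v → 1 ≤ at v k
word-at (px ∷ _)  {suc zero}    _ _          = px
word-at (_ ∷ wv) {suc (suc k)} _ (s≤s k≤n) = word-at wv (s≤s z≤n) k≤n

at⇒Word : ∀ v → (∀ k → 1 ≤ k → k ≤ length v → 1 ≤ at v k) → Word v
at⇒Word []      h = []
at⇒Word (x ∷ v) h =
  h 1 (s≤s z≤n) (s≤s z≤n) ∷ at⇒Word v (λ { (suc k) _ k≤n → h (suc (suc k)) (s≤s z≤n) (s≤s k≤n) })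

¬Flat⇒large-letter : ∀ {v} → Word v → ¬ Flat v → ∃ λ k → 2 ≤ at v k
¬Flat⇒large-letter {[]}    _          nf = ⊥-elim (nf [])
¬Flat⇒large-letter {x ∷ v} (1≤x ∷ wv) nf with x ≟ 1
... | no  x≢1  = 1 , ≤∧≢⇒< 1≤x (x≢1 ∘ sym)
... | yes refl with ¬Flat⇒large-letter wv (nf ∘ (refl ∷_))
...   | zero  , 2≤a = ⊥-elim (<⇒≱ 2≤a (subst (_≤ 1) (sym (at-zero v)) z≤n))
...   | suc k , 2≤a = suc (suc k) , 2≤a

¬Flat⇒nonempty : ∀ {v} → ¬ Flat v → 1 ≤ length v
¬Flat⇒nonempty {[]}    nf = ⊥-elim (nf [])
¬Flat⇒nonempty {_ ∷ _} _  = s≤s z≤n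

Flat⇒at≤1 : ∀ {v} → Flat v → ∀ k → at v k ≤ 1
Flat⇒at≤1 []         k             = z≤n
Flat⇒at≤1 (_ ∷ _)    zero          = z≤n
Flat⇒at≤1 (refl ∷ _) (suc zero)    = ≤-refl
Flat⇒at≤1 (_ ∷ f)    (suc (suc k)) = Flat⇒at≤1 f (suc k)

at≡1⇒Flat : ∀ v → (∀ k → 1 ≤ k → k ≤ length v → at v k ≡ 1) → Flat v
at≡1⇒Flat []      h = []
at≡1⇒Flat (x ∷ v) h =
  h 1 (s≤s z≤n) (s≤s z≤n) ∷
  at≡1⇒Flat v (λ { (suc k) _ k≤n → h (suc (suc k)) (s≤s z≤n) (s≤s k≤n) })

removeZeros-Word : ∀ {v} → Word v → removeZeros v ≡ v
removeZeros-Word []                     = refl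
removeZeros-Word {suc x ∷ v} (_ ∷ wv) = cong (suc x ∷_) (removeZeros-Word wv)

removeZeros-++ : ∀ xs ys → removeZeros (xs ++ ys) ≡ removeZeros xs ++ removeZeros ys
removeZeros-++ []           ys = refl
removeZeros-++ (zero ∷ xs)  ys = removeZeros-++ xs ys
removeZeros-++ (suc x ∷ xs) ys = cong (suc x ∷_) (removeZeros-++ xs ys)

removeZeros-zeros : ∀ b → removeZeros (replicate b 0) ≡ []
removeZeros-zeros zero    = refl
removeZeros-zeros (suc b) = removeZeros-zeros b

-- Weight

≤+≤-equal : ∀ {a b c d} → a ≤ b → c ≤ d → a + c ≡ b + d → a ≡ b × c ≡ d
≤+≤-equal {a} {b} {c} {d} a≤b c≤d eq with m≤n⇒m<n∨m≡n a≤b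
... | inj₁ a<b  = ⊥-elim (<⇒≢ (+-mono-<-≤ a<b c≤d) eq)
... | inj₂ refl = refl , +-cancelˡ-≡ a c d eq

Word-weight-zero : ∀ {w} → Word w → sum w ≡ 0 → w ≡ []
Word-weight-zero []                     _  = refl
Word-weight-zero {suc x ∷ w} (_ ∷ _) ()

at-∷ : ∀ y w {k} → 1 ≤ k → at (y ∷ w) (suc k) ≡ at w k
at-∷ y w {suc k} _ = refl

prefix-weight : ∀ u w → Word w → length u ≤ length w →
  (∀ j → 1 ≤ j → j ≤ length u → at u j ≤ at w j) →
  sum u ≤ sum w × (sum u ≡ sum w → u ≡ w)
prefix-weight []      w       ww _ _ = z≤n , λ eq → sym (Word-weight-zero ww (sym eq))
prefix-weight (x ∷ u) (y ∷ w) (_ ∷ ww) (s≤s len) h =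
  +-mono-≤ x≤y (proj₁ rest) ,
  λ eq → let x≡y , u≡w = ≤+≤-equal x≤y (proj₁ rest) eq in cong₂ _∷_ x≡y (proj₂ rest u≡w)
  where
  x≤y = h 1 (s≤s z≤n) (s≤s z≤n)
  rest = prefix-weight u w ww len λ j 1≤j j≤n →
    subst₂ _≤_ (at-∷ x u 1≤j) (at-∷ y w 1≤j) (h (suc j) (s≤s z≤n) (s≤s j≤n))

factor-weight : ∀ i u w → Word w → i + length u ≤ length w →
  (∀ j → 1 ≤ j → j ≤ length u → at u j ≤ at w (i + j)) →
  sum u ≤ sum w × (sum u ≡ sum w → u ≡ w)
factor-weight zero    u w       ww         len       h = prefix-weight u w ww len h
factor-weight (suc i) u (y ∷ w) (1≤y ∷ ww) (s≤s len) h =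
  ≤-trans (proj₁ rest) (m≤n+m (sum w) y) ,
  λ eq → ⊥-elim (<⇒≢ (<-≤-trans (s≤s (proj₁ rest)) (+-monoˡ-≤ (sum w) 1≤y)) eq)
  where
  rest = factor-weight i u w ww len λ j 1≤j j≤n →
    subst (at u j ≤_) (at-∷ y w (≤-trans 1≤j (m≤n+m j i))) (h j 1≤j j≤n)

≼-weight : ∀ {u w} → Word w → u ≼ w → sum u ≤ sum w × (sum u ≡ sum w → u ≡ w)
≼-weight ww (i , len , h) = factor-weight i _ _ ww len h

≺⇒weight< : ∀ {u w} → Word w → u ≺ w → sum u < sum w
≺⇒weight< ww (u≼w , u≢w) = let ≤-weight , same = ≼-weight ww u≼w in ≤∧≢⇒< ≤-weight (u≢w ∘ same)

weight-suc⇒⋖ : ∀ {v w} → Word v → Word w → v ≼ w → suc (sum v) ≡ sum w → v ⋖ w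
weight-suc⇒⋖ {v} wv ww v≼w eq =
  wv , ww , (v≼w , λ v≡w → <⇒≢ (n<1+n (sum v)) (trans (cong sum v≡w) (sym eq))) ,
  λ x wx v≺x x≺w → <⇒≱ (≺⇒weight< wx v≺x) (≤-pred (subst (sum x <_) (sym eq) (≺⇒weight< ww x≺w)))

-- The embedding η = 0^offset v 0^* of v into w, described position by position.
record Placement (v w η : List ℕ) : Set where
  field
    offset      : ℕ
    length-η    : length η ≡ length w
    fits        : offset + length v ≤ length w
    at-offset   : ∀ m → at η (offset + m) ≡ at v m
    zero-before : ∀ k → k ≤ offset → at η k ≡ 0
    below       : η ⊑ w
open Placement

length-padded : ∀ a (v : List ℕ) b → length (replicate a 0 ++ v ++ replicate b 0) ≡ a + (length v + b)
length-padded a v b = trans (length-++ (replicate a 0))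
  (cong₂ _+_ (length-replicate a) (trans (length-++ v) (cong (length v +_) (length-replicate b))))

at-padded-≤ : ∀ a v b {k} → k ≤ a → at (replicate a 0 ++ v ++ replicate b 0) k ≡ 0
at-padded-≤ a v b {k} k≤a = trans (at-padded a v b k) (trans (cong (at v) (m≤n⇒m∸n≡0 k≤a)) (at-zero v))

toPlacement : ∀ {v w η} → Embedding v w η → Placement v w η
toPlacement {v} {w} ((a , b , refl) , η≤w) = record
  { offset      = a
  ; length-η    = len
  ; fits        = subst (a + length v ≤_) (trans (sym (length-padded a v b)) len)
                    (+-monoʳ-≤ a (m≤m+n (length v) b))
  ; at-offset   = λ m → trans (at-padded a v b (a + m)) (cong (at v) (m+n∸m≡n a m))
  ; zero-before = λ k → at-padded-≤ a v b
  ; below       = pointwise⇒⊑ η≤w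
  }
  where
  len = Pointwise-length η≤w

fromPlacement : ∀ {v w η} → Placement v w η → Embedding v w η
fromPlacement {v} {w} {η} d =
  (a , b , at-injective η padded (trans (length-η d) (sym padded-length)) agree) ,
  ⊑⇒pointwise η w (length-η d) (below d)
  where
  a = offset d
  b = length w ∸ (a + length v)
  padded = replicate a 0 ++ v ++ replicate b 0
  padded-length : length padded ≡ length w
  padded-length = trans (length-padded a v b) (trans (sym (+-assoc a (length v) b)) (m+[n∸m]≡n (fits d)))
  agree : ∀ k → at η k ≡ at padded k
  agree k with k ≤? a
  ... | yes k≤a = trans (zero-before d k k≤a) (sym (at-padded-≤ a v b k≤a))
  ... | no  k≰a = trans (cong (at η) (sym (m+[n∸m]≡n (<⇒≤ (≰⇒> k≰a)))))
                    (trans (at-offset d (k ∸ a)) (sym (at-padded a v b k)))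

module _ {v w η : List ℕ} (d : Placement v w η) where

  support : ∀ {k} → at η k ≢ 0 → ∃ λ m → k ≡ offset d + m × 1 ≤ m × m ≤ length v
  support {k} nz with k ≤? offset d
  ... | yes k≤a = ⊥-elim (nz (zero-before d k k≤a))
  ... | no  k≰a = k ∸ offset d , sym k≡ ,
                  at≢0⇒inRange v (λ e → nz (trans (cong (at η) (sym k≡)) (trans (at-offset d _) e)))
    where
    k≡ : offset d + (k ∸ offset d) ≡ k
    k≡ = m+[n∸m]≡n (<⇒≤ (≰⇒> k≰a))

  support-> : ∀ {k} → at η k ≢ 0 → offset d < k
  support-> nz = let m , k≡ , 1≤m , _ = support nz in subst (offset d <_) (sym k≡) (m<m+n (offset d) 1≤m)

  support-≤ : ∀ {k} → at η k ≢ 0 → k ≤ offset d + length v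
  support-≤ nz = let m , k≡ , _ , m≤n = support nz in
    subst (_≤ offset d + length v) (sym k≡) (+-monoʳ-≤ (offset d) m≤n)

  support-Word : Word v → ∀ {k} → offset d < k → k ≤ offset d + length v → 1 ≤ at η k
  support-Word wv {k} a<k k≤ = subst (1 ≤_) (trans (sym (at-offset d m)) (cong (at η) k≡)) (word-at wv 1≤m m≤n)
    where
    m = k ∸ offset d
    k≡ : offset d + m ≡ k
    k≡ = m+[n∸m]≡n (<⇒≤ a<k)
    1≤m : 1 ≤ m
    1≤m = m<n⇒0<n∸m a<k
    m≤n : m ≤ length v
    m≤n = +-cancelˡ-≤ (offset d) m (length v) (subst (_≤ offset d + length v) (sym k≡) k≤)

nonzero : ∀ {n} → 1 ≤ n → n ≢ 0
nonzero (s≤s _) ()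

≡1⇒≢0 : ∀ {n} → n ≡ 1 → n ≢ 0
≡1⇒≢0 refl ()

sum-zeros : ∀ b → sum (replicate b 0) ≡ 0
sum-zeros zero    = refl
sum-zeros (suc b) = sum-zeros b

sum-embedding : ∀ {v w η} → Embedding v w η → sum η ≡ sum v
sum-embedding {v} ((a , b , refl) , _) = begin
  sum (replicate a 0 ++ v ++ replicate b 0)     ≡⟨ sum-++ (replicate a 0) _ ⟩
  sum (replicate a 0) + sum (v ++ replicate b 0) ≡⟨ cong₂ _+_ (sum-zeros a) (sum-++ v _) ⟩
  sum v + sum (replicate b 0)                    ≡⟨ cong (sum v +_) (sum-zeros b) ⟩
  sum v + 0                                      ≡⟨ +-identityʳ (sum v) ⟩
  sum v                                          ∎
  where open ≡-Reasoning

removeZeros-embedding : ∀ {v w η} → Word v → Embedding v w η → removeZeros η ≡ v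
removeZeros-embedding {v} wv ((a , b , refl) , _) = begin
  removeZeros (replicate a 0 ++ v ++ replicate b 0)
    ≡⟨ removeZeros-++ (replicate a 0) _ ⟩
  removeZeros (replicate a 0) ++ removeZeros (v ++ replicate b 0)
    ≡⟨ cong₂ _++_ (removeZeros-zeros a) (removeZeros-++ v _) ⟩
  removeZeros v ++ removeZeros (replicate b 0)
    ≡⟨ cong₂ _++_ (removeZeros-Word wv) (removeZeros-zeros b) ⟩
  v ++ []
    ≡⟨ ++-identityʳ v ⟩
  v ∎
  where open ≡-Reasoning

embedding-refl : ∀ w → Embedding w w w
embedding-refl w = (0 , 0 , sym (++-identityʳ w)) , ⊑⇒pointwise w w refl (λ _ → ≤-refl)

⊑-shift : ∀ {v v′ w η η′} (d : Placement v w η) (d′ : Placement v′ w η′) → η′ ⊑ η →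
          offset d ≤ offset d′ → ∀ k → at v′ k ≤ at v ((offset d′ ∸ offset d) + k)
⊑-shift {η = η} d d′ η′⊑η a≤a′ k =
  subst₂ _≤_ (at-offset d′ k) (trans (cong (at η) shift) (at-offset d _)) (η′⊑η (offset d′ + k))
  where
  shift : offset d′ + k ≡ offset d + ((offset d′ ∸ offset d) + k)
  shift = trans (cong (_+ k) (sym (m+[n∸m]≡n a≤a′))) (+-assoc (offset d) _ k)

⊑⇒≼ : ∀ {v v′ w η η′} → Word v′ → Placement v w η → Placement v′ w η′ → η′ ⊑ η → v′ ≼ v
⊑⇒≼ {v′ = []}     _   _ _  _    = 0 , z≤n , λ j 1≤j j≤0 → ⊥-elim (<⇒≱ 1≤j j≤0)
⊑⇒≼ {v} {x ∷ v′} {η = η} {η′} wv′ d d′ η′⊑η = i , fits′ , λ j _ _ → ⊑-shift d d′ η′⊑η a≤a′ j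
  where
  n′ = length (x ∷ v′)
  a = offset d
  a′ = offset d′
  occupied : ∀ {j} → 1 ≤ j → j ≤ n′ → at η (a′ + j) ≢ 0
  occupied 1≤j j≤n e =
    <⇒≱ (word-at wv′ 1≤j j≤n) (subst (_≤ 0) (at-offset d′ _) (subst (at η′ _ ≤_) e (η′⊑η _)))
  a≤a′ : a ≤ a′
  a≤a′ = ≤-pred (subst (a <_) (+-comm a′ 1) (support-> d (occupied (s≤s z≤n) (s≤s z≤n))))
  i = a′ ∸ a
  fits′ : i + n′ ≤ length v
  fits′ = +-cancelˡ-≤ a (i + n′) (length v)
    (subst (_≤ a + length v) (trans (cong (_+ n′) (sym (m+[n∸m]≡n a≤a′))) (+-assoc a i n′))
      (support-≤ d (occupied (s≤s z≤n) ≤-refl)))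

-- Reduction steps

ReducibleEmb⇒1≤ : ∀ {v η l} → ReducibleEmb v η l → 1 ≤ at η l
ReducibleEmb⇒1≤ (inj₁ 1<)                 = <⇒≤ 1<
ReducibleEmb⇒1≤ (inj₂ (inj₁ (≡1 , _)))    = ≤-reflexive (sym ≡1)
ReducibleEmb⇒1≤ (inj₂ (inj₂ (_ , ≡1 , _))) = ≤-reflexive (sym ≡1)

reduce-⋖ : ∀ {v v′ w η l} → Word v → Word v′ → Embedding v w η → Embedding v′ w (decAt η l) →
           1 ≤ at η l → v′ ⋖ v
reduce-⋖ {v} {v′} {w} {η} {l} wv wv′ e e′ 1≤ =
  weight-suc⇒⋖ wv′ wv (⊑⇒≼ wv′ (toPlacement e) (toPlacement e′) (decAt-⊑ η l)) weights
  where
  open ≡-Reasoning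
  weights : suc (sum v′) ≡ sum v
  weights = begin
    suc (sum v′)           ≡⟨ cong suc (sym (sum-embedding e′)) ⟩
    suc (sum (decAt η l)) ≡⟨ sum-decAt η l 1≤ ⟩
    sum η                  ≡⟨ sum-embedding e ⟩
    sum v                  ∎

Word-decAt : ∀ {v} → Word v → ∀ {m} → 2 ≤ at v m → Word (decAt v m)
Word-decAt {suc x ∷ v} (_ ∷ wv)  {suc zero}    (s≤s 1≤x) = 1≤x ∷ wv
Word-decAt {x ∷ v}     (px ∷ wv) {suc (suc m)} 2≤        = px ∷ Word-decAt wv 2≤

decAt-placement : ∀ {v w η} (d : Placement v w η) m → 1 ≤ m →
                  Placement (decAt v m) w (decAt η (offset d + m))
decAt-placement {v} {w} {η} d m 1≤m = record
  { offset      = a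
  ; length-η    = trans (length-decAt η (a + m)) (length-η d)
  ; fits        = subst (λ n → a + n ≤ length w) (sym (length-decAt v m)) (fits d)
  ; at-offset   = shifted
  ; zero-before = λ k k≤a → trans (at-decAt-≢ η (λ k≡ → <⇒≱ (m<m+n a 1≤m) (subst (_≤ a) k≡ k≤a)))
                                  (zero-before d k k≤a)
  ; below       = λ k → ≤-trans (decAt-⊑ η (a + m) k) (below d k)
  }
  where
  a = offset d
  shifted : ∀ j → at (decAt η (a + m)) (a + j) ≡ at (decAt v m) j
  shifted j with j ≟ m
  ... | yes refl = trans (at-decAt-≡ η (a + j)) (trans (cong pred (at-offset d j)) (sym (at-decAt-≡ v j)))
  ... | no  j≢m  = trans (at-decAt-≢ η (j≢m ∘ +-cancelˡ-≡ a j m))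
                     (trans (at-offset d j) (sym (at-decAt-≢ v j≢m)))

reduce-large : ∀ {v w η p} → Word v → Embedding v w η → 2 ≤ at η p →
               ∃ λ v′ → Word v′ × Embedding v′ w (decAt η p)
reduce-large {v} {w} {η} wv e 2≤ with support (toPlacement e) (nonzero (≤-trans (s≤s z≤n) 2≤))
... | m , refl , 1≤m , _ =
  decAt v m , Word-decAt wv (subst (2 ≤_) (at-offset d m) 2≤) , fromPlacement (decAt-placement d m 1≤m)
  where
  d = toPlacement e

drop-leading-one : ∀ {x v w η} (d : Placement (x ∷ v) w η) → at η (offset d + 1) ≡ 1 →
                   Placement v w (decAt η (offset d + 1))
drop-leading-one {x} {v} {w} {η} d η≡1 = record
  { offset      = a + 1
  ; length-η    = trans (length-decAt η (a + 1)) (length-η d)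
  ; fits        = subst (_≤ length w) (sym (+-assoc a 1 (length v))) (fits d)
  ; at-offset   = shifted
  ; zero-before = before
  ; below       = λ k → ≤-trans (decAt-⊑ η (a + 1) k) (below d k)
  }
  where
  a = offset d
  shifted : ∀ j → at (decAt η (a + 1)) (a + 1 + j) ≡ at v j
  shifted zero    = trans (cong (at (decAt η (a + 1))) (+-identityʳ (a + 1)))
                      (trans (at-decAt-≡ η (a + 1)) (trans (cong pred η≡1) (sym (at-zero v))))
  shifted (suc j) = trans (at-decAt-≢ η (λ e → <⇒≢ (m<m+n (a + 1) (s≤s z≤n)) (sym e)))
                      (trans (cong (at η) (+-assoc a 1 (suc j))) (at-offset d (suc (suc j))))
  before : ∀ k → k ≤ a + 1 → at (decAt η (a + 1)) k ≡ 0
  before k k≤ with k ≟ a + 1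
  ... | yes refl = trans (at-decAt-≡ η k) (cong pred η≡1)
  ... | no  k≢   = trans (at-decAt-≢ η k≢)
                     (zero-before d k (≤-pred (subst (k <_) (+-comm a 1) (≤∧≢⇒< k≤ k≢))))

first-nonzero-offset : ∀ {v w η k} → Word v → (d : Placement v w η) → at η k ≢ 0 →
                       (∀ j → j < k → at η j ≡ 0) → k ≡ offset d + 1
first-nonzero-offset {v} {η = η} wv d nz leading with support d nz
... | m , refl , 1≤m , m≤n = cong (offset d +_) (≤-antisym (≮⇒≥ 1≮m) 1≤m)
  where
  1≮m : ¬ 1 < m
  1≮m 1<m = nonzero (subst (1 ≤_) (sym (at-offset d 1)) (word-at wv ≤-refl (≤-trans 1≤m m≤n)))
                    (leading (offset d + 1) (+-monoʳ-< (offset d) 1<m))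

reduce-first : ∀ {v w η k} → Word v → Embedding v w η → at η k ≡ 1 → (∀ j → j < k → at η j ≡ 0) →
               ∃ λ v′ → Word v′ × Embedding v′ w (decAt η k)
reduce-first {[]} _ e η≡1 _ =
  let _ , _ , 1≤m , m≤0 = support (toPlacement e) (≡1⇒≢0 η≡1) in ⊥-elim (<⇒≱ 1≤m m≤0)
reduce-first {x ∷ v} wxv@(_ ∷ wv) e η≡1 leading
  with first-nonzero-offset wxv (toPlacement e) (≡1⇒≢0 η≡1) leading
... | refl = v , wv , fromPlacement (drop-leading-one (toPlacement e) η≡1)

reduce : ∀ {v w η k} → Word v → Embedding v w η → 1 ≤ at η k →
         2 ≤ at η k ⊎ (∀ j → j < k → at η j ≡ 0) →
         ∃ λ v′ → Word v′ × Embedding v′ w (decAt η k) × ReducibleEmb v η k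
reduce wv e 1≤ large-or-first with large-or-first | m≤n⇒m<n∨m≡n 1≤
... | inj₁ 2≤      | _       = let v′ , wv′ , e′ = reduce-large wv e 2≤ in v′ , wv′ , e′ , inj₁ 2≤
... | inj₂ _       | inj₁ 2≤ = let v′ , wv′ , e′ = reduce-large wv e 2≤ in v′ , wv′ , e′ , inj₁ 2≤
... | inj₂ leading | inj₂ 1≡ =
  let v′ , wv′ , e′ = reduce-first wv e (sym 1≡) leading
  in v′ , wv′ , e′ , inj₂ (inj₁ (sym 1≡ , nonzero 1≤ , leading))

vanishing-⊑ : ∀ {η η′} → η′ ⊑ η → ∀ {j} → at η j ≡ 0 → at η′ j ≡ 0
vanishing-⊑ {η′ = η′} η′⊑η {j} η≡0 = n≤0⇒n≡0 (subst (at η′ j ≤_) η≡0 (η′⊑η j))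

reducible-⊑ : ∀ {v v′ η η′ q} → ¬ Flat v′ → η′ ⊑ η → at η′ q ≡ at η q →
              ReducibleEmb v η q → ReducibleEmb v′ η′ q
reducible-⊑ _  _     eq (inj₁ 1<) = inj₁ (subst (1 <_) (sym eq) 1<)
reducible-⊑ {η = η} {η′} _  η′⊑η eq (inj₂ (inj₁ (≡1 , nz , before))) =
  inj₂ (inj₁ (trans eq ≡1 , nz ∘ trans (sym eq) , λ j j< → vanishing-⊑ {η} {η′} η′⊑η (before j j<)))
reducible-⊑ {η = η} {η′} nf η′⊑η eq (inj₂ (inj₂ (_ , ≡1 , nz , after))) =
  inj₂ (inj₂ (nf , trans eq ≡1 , nz ∘ trans (sym eq) ,
              λ j j> → vanishing-⊑ {η} {η′} η′⊑η (after j j>)))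

embedding-¬Flat : ∀ {v w η k} → Embedding v w η → 2 ≤ at η k → ¬ Flat v
embedding-¬Flat e 2≤ flat with support (toPlacement e) (nonzero (≤-trans (s≤s z≤n) 2≤))
... | m , refl , _ = <⇒≱ 2≤ (subst (_≤ 1) (sym (at-offset (toPlacement e) m)) (Flat⇒at≤1 flat m))

reducible-self⇒ReducibleWord : ∀ {w j} → Word w → ReducibleEmb w w j → ReducibleWord w j
reducible-self⇒ReducibleWord ww (inj₁ 1<) = inj₁ 1<
reducible-self⇒ReducibleWord {w} {zero} ww (inj₂ (inj₁ (_ , nz , _))) = ⊥-elim (nz (at-zero w))
reducible-self⇒ReducibleWord {w} {suc zero} ww (inj₂ (inj₁ (≡1 , _ , _))) = inj₂ (inj₁ (≡1 , refl))
reducible-self⇒ReducibleWord {w} {suc (suc j)} ww (inj₂ (inj₁ (_ , nz , before))) =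
  ⊥-elim (nonzero (word-at ww ≤-refl (≤-trans (s≤s z≤n) (proj₂ (at≢0⇒inRange w nz))))
                  (before 1 (s≤s (s≤s z≤n))))
reducible-self⇒ReducibleWord {w} {j} ww (inj₂ (inj₂ (nf , ≡1 , nz , after)))
  with at≢0⇒inRange w nz
... | 1≤j , j≤n with m≤n⇒m<n∨m≡n j≤n
...   | inj₂ j≡n = inj₂ (inj₂ (≡1 , j≡n , nf))
...   | inj₁ j<n = ⊥-elim (nonzero (word-at ww (≤-trans 1≤j j≤n) ≤-refl) (after (length w) j<n))

all-≤-or-split : ∀ n xs → All (_≤ n) xs ⊎ ∃ λ A → ∃ λ b → ∃ λ B → xs ≡ A ++ b ∷ B × n < b
all-≤-or-split n []       = inj₁ []
all-≤-or-split n (x ∷ xs) with x ≤? n | all-≤-or-split n xs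
... | no  x≰n | _                              = inj₂ ([] , x , xs , refl , ≰⇒> x≰n)
... | yes x≤n | inj₁ xs≤n                      = inj₁ (x≤n ∷ xs≤n)
... | yes _   | inj₂ (A , b , B , refl , n<b) = inj₂ (x ∷ A , b , B , refl , n<b)

<lex-at : ∀ A {p b X Y} → p < b → (A ++ p ∷ X) <lex (A ++ b ∷ Y)
<lex-at []      p<b = this p<b
<lex-at (_ ∷ A) p<b = next refl (<lex-at A p<b)

∈-drop : ∀ {A : Set} (xs : List A) x ys {b} → b ≤ length xs → x ∈ drop b (xs ++ x ∷ ys)
∈-drop []       x ys {zero}  _         = here refl
∈-drop (_ ∷ xs) x ys {zero}  _         = there (∈-drop xs x ys z≤n)
∈-drop (_ ∷ xs) x ys {suc b} (s≤s b≤n) = ∈-drop xs x ys b≤n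

drop-all-but-last : ∀ {A : Set} (y : A) xs x z →
                    drop (length (xs ++ x ∷ z ∷ [])) (y ∷ xs ++ x ∷ z ∷ []) ≡ z ∷ []
drop-all-but-last y []       x z = refl
drop-all-but-last y (a ∷ xs) x z = drop-all-but-last a xs x z

module _ {w : List ℕ} where

  lastEmbedding : ∀ {η C ls} → IdsFrom w η C ls → List ℕ
  lastEmbedding (end {η} _)  = η
  lastEmbedding (step _ _ r) = lastEmbedding r

  lastEmbedding-⊑ : ∀ {η C ls} (d : IdsFrom w η C ls) → lastEmbedding d ⊑ η
  lastEmbedding-⊑ (end _) k = ≤-refl
  lastEmbedding-⊑ {η} (step {l = l} _ _ r) k = ≤-trans (lastEmbedding-⊑ r k) (decAt-⊑ η l k)

  headEmbedding : ∀ {η x C ls} → IdsFrom w η (x ∷ C) ls → Embedding x w η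
  headEmbedding (end e)      = e
  headEmbedding (step e _ _) = e

  topEmbedding : ∀ {u t η C ls} → IdsFrom w η C ls → MaxChain u t C → Embedding t w η
  topEmbedding d base       = headEmbedding d
  topEmbedding d (step _ _) = headEmbedding d

  lastEmbedding-embeds : ∀ {u t η C ls} → MaxChain u t C → (d : IdsFrom w η C ls) →
                         Embedding u w (lastEmbedding d)
  lastEmbedding-embeds base         (end e)      = e
  lastEmbedding-embeds (step _ mc) (step _ _ r) = lastEmbedding-embeds mc r

  member-embedding : ∀ {η C ls x} (d : IdsFrom w η C ls) → x ∈ C →
                     ∃ λ ηx → Embedding x w ηx × lastEmbedding d ⊑ ηx
  member-embedding {η} d (here refl)    = η , headEmbedding d , lastEmbedding-⊑ d
  member-embedding (step _ _ r) (there x∈) = member-embedding r x∈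

  lastEmbedding-untouched : ∀ {η C ls k} (d : IdsFrom w η C ls) → All (_≢ k) ls →
                            at (lastEmbedding d) k ≡ at η k
  lastEmbedding-untouched (end _) _ = refl
  lastEmbedding-untouched {η} (step _ _ r) (l≢k ∷ ls≢k) =
    trans (lastEmbedding-untouched r ls≢k) (at-decAt-≢ η (l≢k ∘ sym))

  castIds : ∀ {η η′ C ls ls′} → η ≡ η′ → ls ≡ ls′ → IdsFrom w η C ls → IdsFrom w η′ C ls′
  castIds refl refl d = d

  lastEmbedding-castIds : ∀ {η η′ C ls ls′} (η≡ : η ≡ η′) (ls≡ : ls ≡ ls′) (d : IdsFrom w η C ls) →
                          lastEmbedding (castIds η≡ ls≡ d) ≡ lastEmbedding d
  lastEmbedding-castIds refl refl d = refl

  lastStep : ∀ {η C} ls p (d : IdsFrom w η C (ls ++ p ∷ [])) →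
    ∃ λ C₀ → ∃ λ x → ∃ λ y → ∃ λ ηx →
      C ≡ C₀ ++ x ∷ y ∷ [] × Embedding x w ηx × ReducibleEmb x ηx p × lastEmbedding d ≡ decAt ηx p
  lastStep []       p (step {η} e r (end _)) = [] , _ , _ , η , refl , e , r , refl
  lastStep (_ ∷ ls) p (step {v = v} _ _ r) =
    let C₀ , x , y , ηx , C≡ , ex , rx , last≡ = lastStep ls p r
    in v ∷ C₀ , x , y , ηx , cong (v ∷_) C≡ , ex , rx , last≡

MaxChain-Word : ∀ {u t C} → Word u → MaxChain u t C → Word t
MaxChain-Word wu base                 = wu
MaxChain-Word _  (step (_ , wt , _) _) = wt

MaxChain-last : ∀ {u t} C₀ {x y} → MaxChain u t (C₀ ++ x ∷ y ∷ []) → y ≡ u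
MaxChain-last []       (step _ base)        = refl
MaxChain-last []       (step _ (step _ ()))
MaxChain-last (_ ∷ [])     (step _ mc)     = MaxChain-last [] mc
MaxChain-last (_ ∷ c ∷ C₀) (step _ mc)     = MaxChain-last (c ∷ C₀) mc

MaxChain-bottom∈ : ∀ {u t C} → MaxChain u t C → u ∈ C
MaxChain-bottom∈ base        = here refl
MaxChain-bottom∈ (step _ mc) = there (MaxChain-bottom∈ mc)

top∈take : ∀ {u t C} → MaxChain u t C → ∀ n → t ∈ take (suc n) C
top∈take base       n = here refl
top∈take (step _ _) n = here refl

MaxChain-singleton : ∀ {u t v} → MaxChain u t (v ∷ []) → u ≡ t
MaxChain-singleton base         = refl
MaxChain-singleton (step _ ())

-- Greedy descent to a suffix-aligned embedding

least-or-none : (P : ℕ → Set) → (∀ k → Dec (P k)) → ∀ N →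
  (∀ k → k < N → ¬ P k) ⊎ ∃ λ k → k < N × P k × (∀ j → j < k → ¬ P j)
least-or-none P P? zero = inj₁ λ k ()
least-or-none P P? (suc N) with least-or-none P P? N
... | inj₂ (k , k<N , Pk , least) = inj₂ (k , m≤n⇒m≤1+n k<N , Pk , least)
... | inj₁ none with P? N
...   | yes PN = inj₂ (N , ≤-refl , PN , none)
...   | no ¬PN = inj₁ λ k k≤N → [ none k , (λ { refl → ¬PN }) ]′ (m≤n⇒m<n∨m≡n (≤-pred k≤N))

module Descent {u w ε : List ℕ} (wu : Word u) (eε : Embedding u w ε)
               (aligned : offset (toPlacement eε) + length u ≡ length w) where

  private
    dε = toPlacement eε

  -- ε being suffix-aligned, a position where η exceeds ε by a single 1 lies before the copy of u
  -- in ε, so η vanishes before it.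
  first-excess-reducible : ∀ {η k} → ε ⊑ η → k ≤ length w → at ε k < at η k →
    (∀ j → j < k → ¬ at ε j < at η j) → 2 ≤ at η k ⊎ (∀ j → j < k → at η j ≡ 0)
  first-excess-reducible {η} {k} ε⊑η k≤n ε<η first with m≤n⇒m<n∨m≡n (≤-trans (s≤s z≤n) ε<η)
  ... | inj₁ 2≤  = inj₁ 2≤
  ... | inj₂ 1≡ = inj₂ λ j j<k →
    trans (≤-antisym (≮⇒≥ (first j j<k)) (ε⊑η j)) (zero-before dε j (<⇒≤ (<-≤-trans j<k k≤a)))
    where
    ε≡0 : at ε k ≡ 0
    ε≡0 = n≤0⇒n≡0 (≤-pred (subst (at ε k <_) (sym 1≡) ε<η))
    k≤a : k ≤ offset dε
    k≤a = ≮⇒≥ λ a<k → nonzero (support-Word dε wu a<k (subst (k ≤_) (sym aligned) k≤n)) ε≡0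

  descend : ∀ n {v η} → Word v → Embedding v w η → ε ⊑ η → sum η ≤ n →
            ∃ λ C → ∃ λ ls → IdsFrom w η C ls × MaxChain u v C
  descend n {v} {η} wv e ε⊑η bound
    with least-or-none (λ k → at ε k < at η k) (λ k → at ε k <? at η k) (suc (length w)) | n
  ... | inj₁ none | _ = v ∷ [] , [] , end e , subst (λ t → MaxChain u t (t ∷ [])) (sym v≡u) base
    where
    d = toPlacement e
    agree : ∀ k → at η k ≡ at ε k
    agree k with k ≤? length w
    ... | yes k≤n = ≤-antisym (≮⇒≥ (none k (s≤s k≤n))) (ε⊑η k)
    ... | no  k≰n = trans (at-beyond η (subst (_< k) (sym (length-η d)) (≰⇒> k≰n)))
                      (sym (at-beyond ε (subst (_< k) (sym (length-η dε)) (≰⇒> k≰n))))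
    v≡u : v ≡ u
    v≡u = begin
      v               ≡⟨ sym (removeZeros-embedding wv e) ⟩
      removeZeros η   ≡⟨ cong removeZeros (at-injective η ε (trans (length-η d) (sym (length-η dε))) agree) ⟩
      removeZeros ε   ≡⟨ removeZeros-embedding wu eε ⟩
      u               ∎
      where open ≡-Reasoning
  ... | inj₂ (k , k≤n , ε<η , first) | zero =
    ⊥-elim (<⇒≱ (<-≤-trans (≤-<-trans z≤n ε<η) (at≤sum η k)) bound)
  ... | inj₂ (k , k≤n , ε<η , first) | suc n =
    let v′ , wv′ , e′ , red = reduce wv e 1≤ (first-excess-reducible {η} ε⊑η (≤-pred k≤n) ε<η first)
        C , ls , d , mc     = descend n wv′ e′ ε⊑η′
                                (≤-pred (subst (_≤ suc n) (sym (sum-decAt η k 1≤)) bound))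
    in v ∷ C , k ∷ ls , step e red d , step (reduce-⋖ wv wv′ e e′ 1≤) mc
    where
    1≤ : 1 ≤ at η k
    1≤ = ≤-trans (s≤s z≤n) ε<η
    ε⊑η′ : ε ⊑ decAt η k
    ε⊑η′ j with j ≟ k
    ... | yes refl = subst (at ε j ≤_) (sym (at-decAt-≡ η j)) (pred-mono-≤ ε<η)
    ... | no  j≢k  = subst (at ε j ≤_) (sym (at-decAt-≢ η j≢k)) (ε⊑η j)

-- Exchanging steps of a chain id

1≤pred⇒2≤ : ∀ {m n} → 1 ≤ m → m ≤ pred n → 2 ≤ n
1≤pred⇒2≤ {n = suc (suc n)} _ _ = s≤s (s≤s z≤n)
1≤pred⇒2≤ {n = suc zero} (s≤s z≤n) ()
1≤pred⇒2≤ {n = zero}     (s≤s z≤n) ()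

-- The hypotheses on the last embedding keep the moved letter at least 2 until it is
-- reduced, and keep every word on the way non-flat.
move-last-step-to-front : ∀ {u w η t D} B p (d : IdsFrom w η D (B ++ p ∷ [])) → MaxChain u t D → Word u →
  1 ≤ at (lastEmbedding d) p → (∃ λ k → 2 ≤ at (lastEmbedding d) k) →
  ∃ λ D′ → Σ (IdsFrom w η D′ (p ∷ B)) λ d′ → MaxChain u t D′ × lastEmbedding d′ ≡ lastEmbedding d
move-last-step-to-front [] p d mc wu _ _ = _ , d , mc , refl
move-last-step-to-front {u} {w} {η} (q ∷ B) p (step e r d) (step cov mc) wu 1≤ large
  with move-last-step-to-front B p d mc wu 1≤ large
... | _ , step _ _ d′ , step _ mc′ , last≡ =
  _ , step e (inj₁ 2≤η) (step e′ rq d″) ,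
  step (reduce-⋖ {η = η} {l = p} wt wt′ e e′ (<⇒≤ 2≤η))
       (step (reduce-⋖ {η = decAt η p} {l = q} wt′ (MaxChain-Word wu mc′) e′ (topEmbedding d″ mc′)
                       (ReducibleEmb⇒1≤ {η = decAt η p} rq))
             mc′) ,
  trans (lastEmbedding-castIds (decAt-comm η p q) refl d′) last≡
  where
  ε = lastEmbedding d′
  d″ = castIds (decAt-comm η p q) refl d′
  ε⊑ηqp : ε ⊑ decAt (decAt η q) p
  ε⊑ηqp = lastEmbedding-⊑ d′
  ε⊑ηp : ε ⊑ decAt η p
  ε⊑ηp k = ≤-trans (subst (λ ζ → at ε k ≤ at ζ k) (decAt-comm η p q) (ε⊑ηqp k))
                   (decAt-⊑ (decAt η p) q k)
  2≤ηq : 2 ≤ at (decAt η q) p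
  2≤ηq = 1≤pred⇒2≤ (subst (λ ζ → 1 ≤ at ζ p) (sym last≡) 1≤)
                   (subst (at ε p ≤_) (at-decAt-≡ (decAt η q) p) (ε⊑ηqp p))
  2≤η : 2 ≤ at η p
  2≤η = ≤-trans 2≤ηq (decAt-⊑ η q p)
  wt = MaxChain-Word wu (step cov mc)
  reduced = reduce-large wt e 2≤η
  t′ = proj₁ reduced
  wt′ = proj₁ (proj₂ reduced)
  e′ = proj₂ (proj₂ reduced)
  rq : ReducibleEmb t′ (decAt η p) q
  rq with q ≟ p
  ... | yes refl = inj₁ 2≤ηq
  ... | no  q≢p  = reducible-⊑ {η = η} {decAt η p} nonflat (decAt-⊑ η p) (at-decAt-≢ η q≢p) r
    where
    nonflat = let k , 2≤ε = large in
      embedding-¬Flat e′ (≤-trans (subst (λ ζ → 2 ≤ at ζ k) (sym last≡) 2≤ε) (ε⊑ηp k))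

move-last-step : ∀ {u w η t D} A B p (d : IdsFrom w η D (A ++ B ++ p ∷ [])) → MaxChain u t D → Word u →
  1 ≤ at (lastEmbedding d) p → (∃ λ k → 2 ≤ at (lastEmbedding d) k) →
  ∃ λ D′ → IdsFrom w η D′ (A ++ p ∷ B) × MaxChain u t D′
move-last-step [] B p d mc wu 1≤ large =
  let D′ , d′ , mc′ , _ = move-last-step-to-front B p d mc wu 1≤ large in D′ , d′ , mc′
move-last-step (l ∷ A) B p (step e r d) (step cov mc) wu 1≤ large =
  let D′ , d′ , mc′ = move-last-step A B p d mc wu 1≤ large in _ , step e r d′ , step cov mc′

-- Embeddings of a maximal outer factor

positions : (ℕ → ℕ) → ℕ → List ℕ
positions f zero    = []
positions f (suc n) = f 1 ∷ positions (f ∘ suc) n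

length-positions : ∀ f n → length (positions f n) ≡ n
length-positions f zero    = refl
length-positions f (suc n) = cong suc (length-positions (f ∘ suc) n)

at-positions : ∀ f n {k} → 1 ≤ k → k ≤ n → at (positions f n) k ≡ f k
at-positions f (suc n) {suc zero}    _ _         = refl
at-positions f (suc n) {suc (suc k)} _ (s≤s k≤n) = at-positions (f ∘ suc) n (s≤s z≤n) k≤n

-- The letterwise minimum of w and w shifted by the offset of an inner embedding of u
-- is an outer factor that is longer than u and contains it.
inner-embedding⇒¬maximal : ∀ {u w ε} → Word w → MaximalOuterFactor u w → (e : Embedding u w ε) →
  0 < offset (toPlacement e) → offset (toPlacement e) + length u < length w → ⊥
inner-embedding⇒¬maximal {u} {w} {ε} ww ((_ , _ , (_ , prefix) , _) , maximal) e 0<a end<n =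
  maximal q outer u<q u≼q
  where
  d = toPlacement e
  a = offset d
  n = length w ∸ a
  f : ℕ → ℕ
  f k = at w k ⊓ at w (a + k)
  q = positions f n
  a≤n : a ≤ length w
  a≤n = ≤-trans (m≤m+n a (length u)) (<⇒≤ end<n)
  q-length : length q ≡ n
  q-length = length-positions f n
  at-q : ∀ {k} → 1 ≤ k → k ≤ length q → at q k ≡ f k
  at-q 1≤k k≤q = at-positions f n 1≤k (subst (_ ≤_) q-length k≤q)
  n≤ : n ≤ length w
  n≤ = m∸n≤m (length w) a
  q-shift : length w ∸ length q ≡ a
  q-shift = trans (cong (length w ∸_) q-length) (m∸[m∸n]≡n a≤n)
  wq : Word q
  wq = at⇒Word q λ k 1≤k k≤q → subst (1 ≤_) (sym (at-q 1≤k k≤q))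
    (⊓-glb (word-at ww 1≤k (≤-trans (subst (_ ≤_) q-length k≤q) n≤))
           (word-at ww (≤-trans 1≤k (m≤n+m k a))
             (subst (a + k ≤_) (m+[n∸m]≡n a≤n) (+-monoʳ-≤ a (subst (_ ≤_) q-length k≤q)))))
  outer : OuterFactor q w
  outer = wq , subst (_< length w) (sym q-length) (∸-monoʳ-< 0<a a≤n) ,
          (subst (_≤ length w) (sym q-length) n≤ ,
           λ k 1≤k k≤q → subst (_≤ at w k) (sym (at-q 1≤k k≤q)) (m⊓n≤m _ _)) ,
          (subst (_≤ length w) (sym q-length) n≤ ,
           λ k 1≤k k≤q → subst₂ _≤_ (sym (at-q 1≤k k≤q)) (cong (λ b → at w (b + k)) (sym q-shift))
                                   (m⊓n≤n _ _))
  u<q : length u < length q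
  u<q = subst (length u <_) (sym q-length)
          (+-cancelˡ-< a (length u) n (subst (a + length u <_) (sym (m+[n∸m]≡n a≤n)) end<n))
  u≼q : u ≼ q
  u≼q = 0 , <⇒≤ u<q , λ j 1≤j j≤u → subst (at u j ≤_) (sym (at-q 1≤j (≤-trans j≤u (<⇒≤ u<q))))
          (⊓-glb (prefix j 1≤j j≤u) (subst (_≤ at w (a + j)) (at-offset d j) (below d (a + j))))

MaximalOuterFactor-placement : ∀ {u w ε} → Word w → MaximalOuterFactor u w → (e : Embedding u w ε) →
  offset (toPlacement e) ≡ 0 ⊎ offset (toPlacement e) + length u ≡ length w
MaximalOuterFactor-placement ww mof e with offset (toPlacement e) in a≡
... | zero  = inj₁ refl
... | suc a with m≤n⇒m<n∨m≡n (fits (toPlacement e))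
...   | inj₂ end≡ = inj₂ (trans (cong (_+ _) (sym a≡)) end≡)
...   | inj₁ end< = ⊥-elim (inner-embedding⇒¬maximal ww mof e (subst (0 <_) (sym a≡) (s≤s z≤n)) end<)

Suffix⇒Embedding : ∀ {u w} → Suffix u w → Embedding u w (replicate (length w ∸ length u) 0 ++ u ++ [])
Suffix⇒Embedding {u} {w} (u≤w , suffix) = (a , 0 , refl) , ⊑⇒pointwise _ w len below-w
  where
  a = length w ∸ length u
  len : length (replicate a 0 ++ u ++ []) ≡ length w
  len = trans (length-padded a u 0) (trans (cong (a +_) (+-identityʳ (length u))) (m∸n+n≡m u≤w))
  below-w : (replicate a 0 ++ u ++ []) ⊑ w
  below-w k with k ≤? a
  ... | yes k≤a = subst (_≤ at w k) (sym (at-padded-≤ a u 0 k≤a)) z≤n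
  ... | no  k≰a with (k ∸ a) ≤? length u
  ...   | yes m≤u = subst₂ _≤_ (sym (at-padded a u 0 k)) (cong (at w) (m+[n∸m]≡n (<⇒≤ (≰⇒> k≰a))))
                      (suffix (k ∸ a) (m<n⇒0<n∸m (≰⇒> k≰a)) m≤u)
  ...   | no  m≰u = subst (_≤ at w k) (sym (trans (at-padded a u 0 k) (at-beyond u (≰⇒> m≰u)))) z≤n

Suffix-refl : ∀ u → Suffix u u
Suffix-refl u = ≤-refl , λ k _ _ → ≤-reflexive (cong (λ a → at u (a + k)) (sym (n∸n≡0 (length u))))

⊑-end-aligned⇒Suffix : ∀ {u v w ε η} (dε : Placement u w ε) → Word u → 1 ≤ length u →
  (e : Embedding v w η) → ε ⊑ η → offset dε + length u ≡ offset (toPlacement e) + length v → Suffix u v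
⊑-end-aligned⇒Suffix {u} {v} {w} {ε} {η} dε wu 1≤u e ε⊑η aligned = u≤v , suffix
  where
  dv = toPlacement e
  c = offset dε
  a = offset dv
  first-letter : 1 ≤ at η (c + 1)
  first-letter = ≤-trans (subst (1 ≤_) (sym (at-offset dε 1)) (word-at wu ≤-refl 1≤u)) (ε⊑η (c + 1))
  a≤c : a ≤ c
  a≤c = ≤-pred (subst (a <_) (+-comm c 1) (support-> dv (nonzero first-letter)))
  v≡ : length v ≡ (c ∸ a) + length u
  v≡ = +-cancelˡ-≡ a _ _ (trans (sym aligned)
         (trans (cong (_+ length u) (sym (m+[n∸m]≡n a≤c))) (+-assoc a (c ∸ a) (length u))))
  u≤v : length u ≤ length v
  u≤v = subst (length u ≤_) (sym v≡) (m≤n+m (length u) (c ∸ a))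
  suffix : ∀ k → 1 ≤ k → k ≤ length u → at u k ≤ at v ((length v ∸ length u) + k)
  suffix k _ _ = subst (λ b → at u k ≤ at v (b + k))
                   (sym (trans (cong (_∸ length u) v≡) (m+n∸n≡m (c ∸ a) (length u))))
                   (⊑-shift dv dε ε⊑η a≤c k)

⊑-suffix-aligned⇒Suffix : ∀ {u v w ε η} (dε : Placement u w ε) → Word u → 1 ≤ length u →
  offset dε + length u ≡ length w → (e : Embedding v w η) → ε ⊑ η → Suffix u v
⊑-suffix-aligned⇒Suffix {u} {v} {w} {ε} {η} dε wu 1≤u aligned e ε⊑η =
  ⊑-end-aligned⇒Suffix dε wu 1≤u e ε⊑η (trans aligned (sym v-aligned))
  where
  last-letter : 1 ≤ at η (length w)
  last-letter = ≤-trans (subst (1 ≤_) (sym (trans (cong (at ε) (sym aligned)) (at-offset dε (length u))))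
                          (word-at wu 1≤u ≤-refl))
                        (ε⊑η (length w))
  v-aligned : offset (toPlacement e) + length v ≡ length w
  v-aligned = ≤-antisym (fits (toPlacement e)) (support-≤ (toPlacement e) (nonzero last-letter))

self-shift⇒Flat : ∀ {u η p} s → Word u → 1 ≤ s → (∀ k → at u k ≤ at η (s + k)) →
                  (∀ k → k ≢ p → at η k ≡ at u k) → at η p ≡ 1 → Flat u
self-shift⇒Flat {u} {η} {p} s wu 1≤s u≤η agree η≡1 =
  at≡1⇒Flat u λ k 1≤k k≤u → ≤-antisym (≤1 (suc (length u)) k (k+n k)) (word-at wu 1≤k k≤u)
  where
  k+n : ∀ k → length u < k + suc (length u)
  k+n k = subst (length u <_) (sym (+-suc k (length u))) (s≤s (m≤n+m (length u) k))
  ≤1 : ∀ N k → length u < k + N → at u k ≤ 1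
  ≤1 N k u<k+N with k ≤? length u
  ... | no  k≰u = subst (_≤ 1) (sym (at-beyond u (≰⇒> k≰u))) z≤n
  ≤1 zero    k u<k | yes k≤u = ⊥-elim (<⇒≱ (subst (length u <_) (+-identityʳ k) u<k) k≤u)
  ≤1 (suc N) k u<k+N | yes _ with s + k ≟ p
  ... | yes s+k≡p = ≤-trans (u≤η k) (≤-reflexive (trans (cong (at η) s+k≡p) η≡1))
  ... | no  s+k≢p = ≤-trans (u≤η k) (subst (_≤ 1) (sym (agree (s + k) s+k≢p))
                      (≤1 N (s + k) (<-≤-trans u<k+N (subst (_≤ s + k + N) (sym (+-suc k N))
                                                        (+-monoˡ-≤ N (+-monoˡ-≤ k 1≤s))))))

-- Chains below a principal factor

module Principal {u w : List ℕ} {i : ℕ} (ww : Word w) (wu : Word u) (pf : PrincipalFactor u w i) where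

  private
    mof : MaximalOuterFactor u w
    mof = proj₁ pf

    u-nonflat : ¬ Flat u
    u-nonflat = proj₁ (proj₂ pf)

    earliest : ∀ j → j < i → ¬ (at u j < at w j × ReducibleWord w j)
    earliest = proj₂ (proj₂ (proj₁ (proj₂ (proj₂ pf))))

    ¬Suffix-lower : ¬ Suffix u (lower w i)
    ¬Suffix-lower = proj₂ (proj₂ (proj₂ pf))

    u-suffix : Suffix u w
    u-suffix = proj₂ (proj₂ (proj₂ (proj₁ mof)))

  u<w : length u < length w
  u<w = proj₁ (proj₂ (proj₁ mof))

  1≤u : 1 ≤ length u
  1≤u = ¬Flat⇒nonempty u-nonflat

  ¬Suffix-first-step : ∀ {v} → Word v → Embedding v w (decAt w i) → ¬ Suffix u v
  ¬Suffix-first-step wv e u⊒v =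
    ¬Suffix-lower (subst (Suffix u) (sym (removeZeros-embedding wv e)) u⊒v)

  ¬single-step : ∀ {v C} → MaxChain u v C → IdsFrom w (decAt w i) C [] → ⊥
  ¬single-step base        (end e) = ¬Suffix-first-step wu e (Suffix-refl u)
  ¬single-step (step _ ()) (end _)

  σ : List ℕ
  σ = replicate (length w ∸ length u) 0 ++ u ++ []

  σ-embedding : Embedding u w σ
  σ-embedding = Suffix⇒Embedding u-suffix

  σ-placement : Placement u w σ
  σ-placement = toPlacement σ-embedding

  σ-aligned : offset σ-placement + length u ≡ length w
  σ-aligned = m∸n+n≡m (<⇒≤ u<w)

  σ⊑decAt-first : σ ⊑ decAt w 1
  σ⊑decAt-first k with k ≟ 1
  ... | yes refl = subst (_≤ at (decAt w 1) 1) (sym (zero-before σ-placement 1 (m<n⇒0<n∸m u<w))) z≤n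
  ... | no  k≢1  = subst (at σ k ≤_) (sym (at-decAt-≢ w k≢1)) (below σ-placement k)

  2≤i : ∀ {v} → Word v → Embedding v w (decAt w i) → 1 ≤ at w i → 2 ≤ i
  2≤i wv e 1≤ with i ≟ 1
  ... | yes i≡1 = ⊥-elim (¬Suffix-first-step wv e (⊑-suffix-aligned⇒Suffix σ-placement wu 1≤u σ-aligned e
                    (subst (λ j → σ ⊑ decAt w j) (sym i≡1) σ⊑decAt-first)))
  ... | no  i≢1 = ≤∧≢⇒< (proj₁ (at≢0⇒inRange w (nonzero 1≤))) (i≢1 ∘ sym)

  chain-via-first : ∃ λ C → ∃ λ ls → MaxChain u w (w ∷ C) × ChainId w (w ∷ C) (1 ∷ ls)
  chain-via-first =
    let v , wv , e , r = reduce ww (embedding-refl w) 1≤w₁ (inj₂ λ { zero _ → at-zero w ; (suc _) (s≤s ()) })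
        C , ls , d , mc = Descent.descend wu σ-embedding σ-aligned (sum (decAt w 1)) wv e σ⊑decAt-first ≤-refl
    in C , ls , step (reduce-⋖ {η = w} {l = 1} ww wv (embedding-refl w) e 1≤w₁) mc , step (embedding-refl w) r d
    where
    1≤w₁ : 1 ≤ at w 1
    1≤w₁ = word-at ww ≤-refl (≤-trans (s≤s z≤n) u<w)

  -- C is w ⋗ v₁ ⋗ ⋯ ⋗ x ⋗ u with chain id i ∷ ini ++ p ∷ [], its last step lowering position p of
  -- the embedding ηx of x.
  module LexFirst {v₁ C₀ x ηx ini p} (cov₀ : v₁ ⋖ w) (mc₁ : MaxChain u v₁ (C₀ ++ x ∷ u ∷ []))
    (r₀ : ReducibleEmb w w i) (d₁ : IdsFrom w (decAt w i) (C₀ ++ x ∷ u ∷ []) (ini ++ p ∷ []))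
    (ex : Embedding x w ηx) (rx : ReducibleEmb x ηx p) (last≡ : lastEmbedding d₁ ≡ decAt ηx p)
    (lex-first : ∀ C″ l″ → MaxChain u w C″ → ChainId w C″ (i ∷ l″) →
                 ¬ ((i ∷ l″) <lex (i ∷ ini ++ p ∷ [])))
    where

    C : List (List ℕ)
    C = w ∷ C₀ ++ x ∷ u ∷ []

    ε : List ℕ
    ε = lastEmbedding d₁

    ε⊑ : ε ⊑ decAt w i
    ε⊑ = lastEmbedding-⊑ d₁

    dε : Placement u w ε
    dε = toPlacement (lastEmbedding-embeds mc₁ d₁)

    wv₁ : Word v₁
    wv₁ = MaxChain-Word wu mc₁

    e₁ : Embedding v₁ w (decAt w i)
    e₁ = topEmbedding d₁ mc₁

    ε-prefix : offset dε ≡ 0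
    ε-prefix with MaximalOuterFactor-placement ww mof (lastEmbedding-embeds mc₁ d₁)
    ... | inj₁ at-start = at-start
    ... | inj₂ at-end   =
      ⊥-elim (¬Suffix-first-step wv₁ e₁ (⊑-suffix-aligned⇒Suffix dε wu 1≤u at-end e₁ ε⊑))

    at-ε : ∀ k → at ε k ≡ at u k
    at-ε k = subst (λ a → at ε (a + k) ≡ at u k) ε-prefix (at-offset dε k)

    skipped : Skipped u w C (i ∷ ini ++ p ∷ []) 0 (length C ∸ 1)
    skipped =
      let C′ , ls′ , mc′ , cid′ = chain-via-first in
      subst (1 <_) (sym (length-++ C₀)) (m≤n+m 2 (length C₀)) , n<1+n _ ,
      w ∷ C′ , 1 ∷ ls′ , mc′ , cid′ , this (2≤i wv₁ e₁ (ReducibleEmb⇒1≤ {η = w} r₀)) ,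
      subst (λ Z → All (_∈ w ∷ C′) (w ∷ Z)) (sym (drop-all-but-last w C₀ x u))
        (here refl ∷ MaxChain-bottom∈ mc′ ∷ [])

    -- If all steps after the first stay within the first |u| positions, the first step
    -- already cleared everything beyond them, and u ends up a suffix of v₁.
    steps-within-u⇒⊥ : All (_≤ length u) (ini ++ p ∷ []) → ⊥
    steps-within-u⇒⊥ steps≤u =
      ¬Suffix-first-step wv₁ e₁ (⊑-end-aligned⇒Suffix dε wu 1≤u e₁ ε⊑
        (trans (cong (_+ length u) ε-prefix) (≤-antisym u≤end end≤u)))
      where
      dv = toPlacement e₁
      cleared : ∀ {k} → length u < k → at (decAt w i) k ≡ 0
      cleared {k} u<k = trans (sym (lastEmbedding-untouched d₁ untouched)) (trans (at-ε k) (at-beyond u u<k))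
        where
        untouched : All (_≢ k) (ini ++ p ∷ [])
        untouched = All.map (λ q≤u q≡k → <⇒≱ u<k (subst (_≤ length u) q≡k q≤u)) steps≤u
      last-letter : at (decAt w i) (length u) ≢ 0
      last-letter = nonzero (≤-trans (subst (1 ≤_) (sym (at-ε (length u))) (word-at wu 1≤u ≤-refl))
                                     (ε⊑ (length u)))
      u≤end : length u ≤ offset dv + length v₁
      u≤end = support-≤ dv last-letter
      end≤u : offset dv + length v₁ ≤ length u
      end≤u = ≮⇒≥ λ u<end →
        nonzero (support-Word dv wv₁ (<-trans (support-> dv last-letter) u<end) ≤-refl) (cleared u<end)

    1≤p : 1 ≤ p
    1≤p = proj₁ (at≢0⇒inRange ηx (nonzero (ReducibleEmb⇒1≤ {η = ηx} rx)))

    -- A last step within u either leaves all steps within u, or moves in front of a step beyond u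
    -- to give a lexicographically smaller chain id.
    u<p : length u < p
    u<p = ≰⇒> λ p≤u → [ (λ ini≤u → steps-within-u⇒⊥ (++⁺ ini≤u (p≤u ∷ []))) , earlier p≤u ]′
                         (all-≤-or-split (length u) ini)
      where
      earlier : p ≤ length u → (∃ λ A → ∃ λ b → ∃ λ B → ini ≡ A ++ b ∷ B × length u < b) → ⊥
      earlier p≤u (A , b , B , ini≡ , u<b) =
        let D , dD , mcD = move-last-step A (b ∷ B) p d₁′ mc₁ wu 1≤εp large in
        lex-first (w ∷ D) (A ++ p ∷ b ∷ B) (step cov₀ mcD) (step (embedding-refl w) r₀ dD)
          (next refl (subst ((A ++ p ∷ b ∷ B) <lex_) (sym reshuffle) (<lex-at A (≤-<-trans p≤u u<b))))
        where
        reshuffle : ini ++ p ∷ [] ≡ A ++ (b ∷ B) ++ p ∷ []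
        reshuffle = trans (cong (_++ p ∷ []) ini≡) (++-assoc A (b ∷ B) (p ∷ []))
        d₁′ = castIds refl reshuffle d₁
        ε≡ : lastEmbedding d₁′ ≡ ε
        ε≡ = lastEmbedding-castIds refl reshuffle d₁
        1≤εp : 1 ≤ at (lastEmbedding d₁′) p
        1≤εp = subst (λ ζ → 1 ≤ at ζ p) (sym ε≡) (subst (1 ≤_) (sym (at-ε p)) (word-at wu 1≤p p≤u))
        large : ∃ λ k → 2 ≤ at (lastEmbedding d₁′) k
        large = let k , 2≤ = ¬Flat⇒large-letter wu u-nonflat in
                k , subst (λ ζ → 2 ≤ at ζ k) (sym ε≡) (subst (2 ≤_) (sym (at-ε k)) 2≤)

    x-agrees : ∀ k → k ≢ p → at ηx k ≡ at u k
    x-agrees k k≢p = trans (sym (at-decAt-≢ ηx k≢p)) (trans (cong (λ ζ → at ζ k) (sym last≡)) (at-ε k))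

    x-at-p : at ηx p ≡ 1
    x-at-p = 1≤∧pred≡0 (ReducibleEmb⇒1≤ {η = ηx} rx)
               (trans (sym (at-decAt-≡ ηx p))
                 (trans (cong (λ ζ → at ζ p) (sym last≡)) (trans (at-ε p) (at-beyond u u<p))))
      where
      1≤∧pred≡0 : ∀ {n} → 1 ≤ n → pred n ≡ 0 → n ≡ 1
      1≤∧pred≡0 (s≤s z≤n) refl = refl

    -- x is u followed by a single 1, so a suffix-aligned copy of u below x is u shifted into itself.
    over-suffix-aligned⇒Flat : ∀ {σ′ η′} (dσ : Placement u w σ′) → offset dσ + length u ≡ length w →
                               Embedding x w η′ → σ′ ⊑ η′ → Flat u
    over-suffix-aligned⇒Flat {σ′} {η′} dσ aligned ex′ σ′⊑η′ =
      self-shift⇒Flat {η = ηx} s wu (m<n⇒0<n∸m a′<o) shifted x-agrees x-at-p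
      where
      dx = toPlacement ex
      dx′ = toPlacement ex′
      o = offset dσ
      a′ = offset dx′
      s = o ∸ a′
      x-prefix : offset dx ≡ 0
      x-prefix = n<1⇒n≡0 (support-> dx (nonzero (subst (1 ≤_) (sym (x-agrees 1 1≢p)) (word-at wu ≤-refl 1≤u))))
        where
        1≢p : 1 ≢ p
        1≢p 1≡p = <⇒≱ u<p (subst (_≤ length u) 1≡p 1≤u)
      p≤x : p ≤ length x
      p≤x = subst (λ a → p ≤ a + length x) x-prefix (support-≤ dx (≡1⇒≢0 x-at-p))
      a′<o : a′ < o
      a′<o = +-cancelʳ-< (length u) a′ o (subst (a′ + length u <_) (sym aligned)
               (<-≤-trans (+-monoʳ-< a′ (<-≤-trans u<p p≤x)) (fits dx′)))
      shifted : ∀ k → at u k ≤ at ηx (s + k)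
      shifted k =
        subst (at u k ≤_) (sym (subst (λ a → at ηx (a + (s + k)) ≡ at x (s + k)) x-prefix (at-offset dx (s + k))))
              (⊑-shift dx′ dσ σ′⊑η′ (<⇒≤ a′<o) k)

    earlier-first-step⇒¬Skipped : ∀ {a′ b′ j v C₁″ ls} → j < i → MaxChain u v C₁″ →
      Embedding w w w → ReducibleEmb w w j → (d″ : IdsFrom w (decAt w j) C₁″ ls) →
      b′ ≤ length C ∸ 1 → ¬ (a′ ≡ 0 × b′ ≡ length C ∸ 1) →
      ¬ All (_∈ w ∷ C₁″) (take (suc a′) C ++ drop b′ C)
    earlier-first-step⇒¬Skipped {a′} {b′} {j} j<i mc″ e″ r″ d″ b′≤ ¬whole kept
      with MaximalOuterFactor-placement ww mof (lastEmbedding-embeds mc″ d″)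
    ... | inj₁ at-start = earliest j j<i (m≤pred[n]⇒suc[m]≤n {{>-nonZero (ReducibleEmb⇒1≤ {η = w} r″)}} u≤ ,
                                          reducible-self⇒ReducibleWord ww r″)
      where
      d = toPlacement (lastEmbedding-embeds mc″ d″)
      u≤ : at u j ≤ pred (at w j)
      u≤ = subst₂ _≤_ (subst (λ a → at (lastEmbedding d″) (a + j) ≡ at u j) at-start (at-offset d j))
                      (at-decAt-≡ w j) (lastEmbedding-⊑ d″ j)
    ... | inj₂ at-end with a′
    ...   | suc a″ =
      let _ , ev , ⊑ev = member-embedding (step e″ r″ d″) (All.lookup kept (∈-++⁺ˡ (there (top∈take mc₁ a″))))
      in ¬Suffix-first-step wv₁ e₁
           (⊑-suffix-aligned⇒Suffix (toPlacement (lastEmbedding-embeds mc″ d″)) wu 1≤u at-end ev ⊑ev)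
    ...   | zero =
      let _ , ex′ , ⊑ex′ = member-embedding (step e″ r″ d″) (All.lookup kept (∈-++⁺ʳ (w ∷ []) x∈))
      in u-nonflat (over-suffix-aligned⇒Flat (toPlacement (lastEmbedding-embeds mc″ d″)) at-end ex′ ⊑ex′)
      where
      b′≤ₓ : b′ ≤ length (w ∷ C₀)
      b′≤ₓ with m≤n⇒m<n∨m≡n (subst (b′ ≤_) (length-++ C₀) b′≤)
      ... | inj₁ b′< = ≤-pred (subst (b′ <_) (+-comm (length C₀) 2) b′<)
      ... | inj₂ b′≡ = ⊥-elim (¬whole (refl , trans b′≡ (sym (length-++ C₀))))
      x∈ : x ∈ drop b′ C
      x∈ = ∈-drop (w ∷ C₀) x (u ∷ []) b′≤ₓ

    minimally-skipped : MinSkipped u w C (i ∷ ini ++ p ∷ []) 0 (length C ∸ 1)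
    minimally-skipped = skipped , minimal
      where
      minimal : ∀ a′ b′ → 0 ≤ a′ → b′ ≤ length C ∸ 1 → ¬ (a′ ≡ 0 × b′ ≡ length C ∸ 1) →
                ¬ Skipped u w C (i ∷ ini ++ p ∷ []) a′ b′
      minimal _ _ _ _ _ (_ , _ , _ , _ , mc″ , end _ , halt , _) =
        <⇒≢ u<w (cong length (MaxChain-singleton mc″))
      minimal _ _ _ _ _ (_ , _ , C″ , _ , mc″ , cid″ , next refl l″<l , _) =
        lex-first C″ _ mc″ cid″ (next refl l″<l)
      minimal _ _ _ b′≤ ¬whole (_ , _ , _ , _ , step _ mc″ , step e″ r″ d″ , this j<i , kept) =
        earlier-first-step⇒¬Skipped j<i mc″ e″ r″ d″ b′≤ ¬whole kept

proposition3p7 : (u w : List ℕ) (i : ℕ) → Word w → Word u →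
    PrincipalFactor u w i →
    (C : List (List ℕ)) (l : List ℕ) →
    MaxChain u w C → ChainId w C (i ∷ l) →
    (∀ C'' l'' → MaxChain u w C'' → ChainId w C'' (i ∷ l'') →
       ¬ ((i ∷ l'') <lex (i ∷ l))) →
    MinSkipped u w C (i ∷ l) 0 (length C ∸ 1)
proposition3p7 u w i ww wu pf _ l (step cov₀ mc₁) (step _ r₀ d₁) lex-first with initLast l
... | [] = ⊥-elim (Principal.¬single-step ww wu pf mc₁ d₁)
... | ini ∷ʳ′ p with lastStep ini p d₁
...   | C₀ , x , _ , _ , refl , ex , rx , last≡ with MaxChain-last C₀ mc₁
...     | refl = Principal.LexFirst.minimally-skipped ww wu pf cov₀ mc₁ r₀ d₁ ex rx last≡ lex-first
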